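{- The function $L:\mathbb{Z}_{\ge0}^2\to\mathbb{Z}$, $L(n,k)=\binom{n}{k}\binom{2k}{n}$, has the double Lucas property.
   Context: A function $L:\mathbb{Z}_{\ge0}^2\to\mathbb{Z}$ has the double Lucas property if $L(n,k)=0$ whenever $k>n$, and for every prime $p$ and all $n,k\ge0$, writing $n=\sum_{i=0}^r n_ip^i$, $k=\sum_{i=0}^r k_ip^i$ with base-$p$ digits $0\le n_i,k_i<p$ (padded with zeros to a common length), $L(n,k)\equiv\prod_{i=0}^r L(n_i,k_i)\pmod p$. -}

module Defs where

open import Data.Nat using (ℕ; zero; suc; _*_; _^_; _<_; NonZero)
open import Data.Nat.DivMod using (_/_; _%_)
open import Data.Nat.Combinatorics using (_C_)
open import Data.Integer using (ℤ; +_; _-_) renaming (_*_ to _*ℤ_)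
open import Data.Integer.Divisibility using () renaming (_∣_ to _∣ℤ_)
open import Data.Nat.Primality using (Prime; prime⇒nonZero)
open import Data.Product using (_×_)
open import Relation.Binary.PropositionalEquality using (_≡_)
open import Data.Nat.Properties using (m^n≢0)

L : ℕ → ℕ → ℤ
L n k = + ((n C k) * ((2 * k) C n))

digit : (p : ℕ) → .{{NonZero p}} → ℕ → ℕ → ℕ
digit p n i = ((n / (p ^ i)) {{m^n≢0 p i}}) % p

digitProd : (f : ℕ → ℕ → ℤ) (p : ℕ) → .{{NonZero p}} → ℕ → ℕ → ℕ → ℤ
digitProd f p n k zero = f (digit p n 0) (digit p k 0)
digitProd f p n k (suc r) = digitProd f p n k r *ℤ f (digit p n (suc r)) (digit p k (suc r))

_≡_[mod_] : ℤ → ℤ → ℕ → Set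
a ≡ b [mod p ] = (+ p) ∣ℤ (a - b)

DoubleLucas : (ℕ → ℕ → ℤ) → Set
DoubleLucas f =
  (∀ n k → n < k → f n k ≡ + 0) ×
  (∀ p → (pr : Prime p) → ∀ n k r →
     n < p ^ suc r → k < p ^ suc r →
     f n k ≡ digitProd f p {{prime⇒nonZero pr}} n k r [mod p ])

-- Writing n = ap + b and k = cp + d with b, d < p, Lucas's theorem
-- (n C k) ≡ (a C c)(b C d) (mod p), proved by induction on n with Pascal's
-- rule and p ∣ (p C j) for 0 < j < p, applies to both factors of
-- L(n,k) = (n C k)(2k C n).  If 2d < p, the last digit of 2k is 2d and
-- L(n,k) ≡ L(a,c) L(b,d) at once.  If 2d ≥ p, then 2k = (2c+1)p + e with
-- e = 2d − p < d, so the factor (b C d)(e C b) vanishes and both sides are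
-- 0 mod p.  Peeling off one base-p digit at a time gives the digit product.
{-# OPTIONS --safe #-}
module Submission where

open import Defs
open import Data.Nat
open import Data.Nat.Properties
open import Data.Nat.DivMod
open import Data.Nat.Divisibility
open import Data.Nat.Combinatorics
open import Data.Nat.Primality
open import Data.Nat.Tactic.RingSolver using (solve-∀)
import Data.Integer as ℤ
import Data.Integer.Properties as ℤ
open import Data.Product using (_,_)
open import Data.Sum using (inj₁; inj₂)
open import Level using (0ℓ)
open import Relation.Binary.Bundles using (Setoid)
import Relation.Binary.Reasoning.Setoid as SetoidReasoning
open import Relation.Nullary using (yes; no; contradiction)
open import Relation.Binary.PropositionalEquality

private variable a b c d : ℕ

module ℕMod (p : ℕ) .{{_ : NonZero p}} where

  -- a record rather than m % p ≡ n % p itself, so that m and n are inferable from a proof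
  infix 4 _≈_
  record _≈_ (m n : ℕ) : Set where
    constructor mod-eq
    field %-eq : m % p ≡ n % p

  ≈-setoid : Setoid 0ℓ 0ℓ
  ≈-setoid = record
    { _≈_           = _≈_
    ; isEquivalence = record
      { refl  = mod-eq refl
      ; sym   = λ (mod-eq e) → mod-eq (sym e)
      ; trans = λ (mod-eq e) (mod-eq f) → mod-eq (trans e f)
      }
    }

  open Setoid ≈-setoid public using ()
    renaming (refl to ≈-refl; sym to ≈-sym; trans to ≈-trans; reflexive to ≡⇒≈)
  module ≈-Reasoning = SetoidReasoning ≈-setoid

  +-cong : a ≈ b → c ≈ d → a + c ≈ b + d
  +-cong {a} {b} {c} {d} (mod-eq e) (mod-eq f) = mod-eq (begin
    (a + c) % p              ≡⟨ %-distribˡ-+ a c p ⟩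
    (a % p + c % p) % p      ≡⟨ cong₂ (λ x y → (x + y) % p) e f ⟩
    (b % p + d % p) % p      ≡⟨ %-distribˡ-+ b d p ⟨
    (b + d) % p              ∎)
    where open ≡-Reasoning

  *-cong : a ≈ b → c ≈ d → a * c ≈ b * d
  *-cong {a} {b} {c} {d} (mod-eq e) (mod-eq f) = mod-eq (begin
    (a * c) % p              ≡⟨ %-distribˡ-* a c p ⟩
    (a % p * (c % p)) % p    ≡⟨ cong₂ (λ x y → (x * y) % p) e f ⟩
    (b % p * (d % p)) % p    ≡⟨ %-distribˡ-* b d p ⟨
    (b * d) % p              ∎)
    where open ≡-Reasoning

  ∣⇒≈0 : p ∣ a → a ≈ 0
  ∣⇒≈0 {a} p∣a = mod-eq (trans (n∣m⇒m%n≡0 a p p∣a) (sym (n∣m⇒m%n≡0 0 p (p ∣0))))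

  ≈⇒∣∸ : a ≈ b → p ∣ b ∸ a
  ≈⇒∣∸ {a} {b} (mod-eq e) = divides (b / p ∸ a / p) (begin
    b ∸ a
      ≡⟨ cong₂ _∸_ (m≡m%n+[m/n]*n b p) (trans (m≡m%n+[m/n]*n a p) (cong (_+ a / p * p) e)) ⟩
    (b % p + b / p * p) ∸ (b % p + a / p * p)
      ≡⟨ [m+n]∸[m+o]≡n∸o (b % p) (b / p * p) (a / p * p) ⟩
    b / p * p ∸ a / p * p
      ≡⟨ *-distribʳ-∸ p (b / p) (a / p) ⟨
    (b / p ∸ a / p) * p ∎)
    where open ≡-Reasoning

  ≈⇒≡[mod] : a ≈ b → (ℤ.+ a) ≡ (ℤ.+ b) [mod p ]
  ≈⇒≡[mod] {a} {b} a≈b rewrite ℤ.m-n≡m⊖n a b with ≤-total a b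
  ... | inj₁ a≤b = subst (p ∣_) (sym (ℤ.∣⊖∣-≤ a≤b)) (≈⇒∣∸ a≈b)
  ... | inj₂ b≤a = subst (p ∣_) (sym (trans (ℤ.∣m⊖n∣≡∣n⊖m∣ a b) (ℤ.∣⊖∣-≤ b≤a)))
                         (≈⇒∣∸ (≈-sym a≈b))

module _ (p : ℕ) .{{_ : NonZero p}} where

  open ℕMod p

  OneStepLucas : (ℕ → ℕ → ℕ) → Set
  OneStepLucas f = ∀ a b c d → b < p → d < p → f (a * p + b) (c * p + d) ≈ f a c * f b d

  digit-zero : ∀ n → digit p n 0 ≡ n % p
  digit-zero n = cong (_% p) (n/1≡n n)

  digit-suc : ∀ n i → digit p n (suc i) ≡ digit p (n / p) i
  digit-suc n i = cong (_% p) (sym (m/n/o≡m/[n*o] n p (p ^ i) {{_}} {{m^n≢0 p i}} {{m^n≢0 p (suc i)}}))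

  digitProductℕ : (ℕ → ℕ → ℕ) → ℕ → ℕ → ℕ → ℕ
  digitProductℕ f n k zero    = f (digit p n 0) (digit p k 0)
  digitProductℕ f n k (suc r) = digitProductℕ f n k r * f (digit p n (suc r)) (digit p k (suc r))

  digitProd-+ : ∀ f n k r → digitProd (λ a b → ℤ.+ f a b) p n k r ≡ ℤ.+ digitProductℕ f n k r
  digitProd-+ f n k zero    = refl
  digitProd-+ f n k (suc r) = trans (cong (ℤ._* ℤ.+ last) (digitProd-+ f n k r))
                                    (sym (ℤ.pos-* (digitProductℕ f n k r) last))
    where last = f (digit p n (suc r)) (digit p k (suc r))

  digitProductℕ-suc : ∀ f n k r →
    digitProductℕ f n k (suc r) ≡ f (n % p) (k % p) * digitProductℕ f (n / p) (k / p) r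
  digitProductℕ-suc f n k zero = cong₂ _*_
    (cong₂ f (digit-zero n) (digit-zero k)) (cong₂ f (digit-suc n 0) (digit-suc k 0))
  digitProductℕ-suc f n k (suc r) = trans
    (cong₂ _*_ (digitProductℕ-suc f n k r) (cong₂ f (digit-suc n (suc r)) (digit-suc k (suc r))))
    (*-assoc (f (n % p) (k % p)) _ _)

  oneStepLucas⇒digitwise : ∀ {f} → OneStepLucas f → ∀ r n k →
    n < p ^ suc r → k < p ^ suc r → f n k ≈ digitProductℕ f n k r
  oneStepLucas⇒digitwise {f} _ zero n k n<p k<p =
    ≡⇒≈ (cong₂ f (single-digit n n<p) (single-digit k k<p))
    where
    single-digit : ∀ m → m < p ^ 1 → m ≡ digit p m 0
    single-digit m m<p = sym (trans (digit-zero m) (m<n⇒m%n≡m (subst (m <_) (*-identityʳ p) m<p)))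
  oneStepLucas⇒digitwise {f} lucas (suc r) n k n< k< = begin
    f n k
      ≡⟨ cong₂ f (split n) (split k) ⟩
    f (n / p * p + n % p) (k / p * p + k % p)
      ≈⟨ lucas (n / p) (n % p) (k / p) (k % p) (m%n<n n p) (m%n<n k p) ⟩
    f (n / p) (k / p) * f (n % p) (k % p)
      ≈⟨ *-cong (oneStepLucas⇒digitwise lucas r (n / p) (k / p) (quotient< n n<) (quotient< k k<))
                ≈-refl ⟩
    digitProductℕ f (n / p) (k / p) r * f (n % p) (k % p)
      ≡⟨ *-comm _ (f (n % p) (k % p)) ⟩
    f (n % p) (k % p) * digitProductℕ f (n / p) (k / p) r
      ≡⟨ digitProductℕ-suc f n k r ⟨
    digitProductℕ f n k (suc r) ∎
    where
    open ≈-Reasoning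
    split : ∀ m → m ≡ m / p * p + m % p
    split m = trans (m≡m%n+[m/n]*n m p) (+-comm (m % p) (m / p * p))
    quotient< : ∀ m → m < p ^ suc (suc r) → m / p < p ^ suc r
    quotient< m m< = m<n*o⇒m/o<n (subst (m <_) (*-comm p (p ^ suc r)) m<)

module BinomialLucas {q : ℕ} (p-prime : Prime (suc q)) where

  private
    p : ℕ
    p = suc q

  open ℕMod p

  p∤m! : ∀ m → m < p → p ∤ m !
  p∤m! zero    _   p∣1 = <⇒≱ (nonTrivial⇒n>1 p {{prime⇒nonTrivial p-prime}}) (∣⇒≤ p∣1)
  p∤m! (suc m) m<p p∣m! with euclidsLemma (suc m) (m !) p-prime p∣m!
  ... | inj₁ p∣1+m = <⇒≱ m<p (∣⇒≤ p∣1+m)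
  ... | inj₂ p∣m!′ = p∤m! m (<-trans (n<1+n m) m<p) p∣m!′

  p∣pCk : ∀ k → 0 < k → k < p → p ∣ p C k
  p∣pCk k 0<k k<p with euclidsLemma (p C k) (k ! * (p ∸ k) !) p-prime p∣[pCk]*k![p∸k]!
    where
    instance _ = m*n≢0 (k !) ((p ∸ k) !) {{k !≢0}} {{(p ∸ k) !≢0}}
    p∣[pCk]*k![p∸k]! : p ∣ (p C k) * (k ! * (p ∸ k) !)
    p∣[pCk]*k![p∸k]! = subst (p ∣_) (sym (begin
      (p C k) * (k ! * (p ∸ k) !)
        ≡⟨ cong (_* (k ! * (p ∸ k) !)) (nCk≡n!/k![n-k]! (<⇒≤ k<p)) ⟩
      p ! / (k ! * (p ∸ k) !) * (k ! * (p ∸ k) !)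
        ≡⟨ m/n*n≡m (k![n∸k]!∣n! (<⇒≤ k<p)) ⟩
      p ! ∎)) (m∣m*n (q !))
      where open ≡-Reasoning
  ... | inj₁ p∣pCk = p∣pCk
  ... | inj₂ p∣k![p∸k]! with euclidsLemma (k !) ((p ∸ k) !) p-prime p∣k![p∸k]!
  ...   | inj₁ p∣k!     = contradiction p∣k! (p∤m! k k<p)
  ...   | inj₂ p∣[p∸k]! = contradiction p∣[p∸k]! (p∤m! (p ∸ k) (∸-monoʳ-< 0<k (<⇒≤ k<p)))

  LucasAt : ℕ → ℕ → ℕ → Set
  LucasAt n a b = ∀ c d → d < p → n C (c * p + d) ≈ (a C c) * (b C d)

  private
    carry : ∀ c → suc (c * p + q) ≡ suc c * p + 0
    carry c = identity c q
      where
      identity : ∀ c q → suc (c * suc q + q) ≡ suc c * suc q + 0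
      identity = solve-∀

  -- (a′, b′) are the digits of n + 1; the hypotheses are the digit-level forms of
  -- Pascal's rule needed when k + 1 is formed without and with a carry.

  LucasAt-suc : ∀ {n a b a′ b′} → LucasAt n a b →
    (∀ c d → suc d < p → (a′ C c) * (b′ C suc d) ≈ (a C c) * (b C d) + (a C c) * (b C suc d)) →
    (∀ c → (a′ C suc c) * (b′ C 0) ≈ (a C c) * (b C q) + (a C suc c) * (b C 0)) →
    LucasAt (suc n) a′ b′
  LucasAt-suc _ _ _ zero zero _ = ≈-refl
  LucasAt-suc {n} {a} {b} {a′} {b′} lucas step _ c (suc d) 1+d<p = begin
    suc n C (c * p + suc d)
      ≡⟨ cong (suc n C_) (+-suc (c * p) d) ⟩
    suc n C suc (c * p + d)
      ≡⟨ nCk+nC[k+1]≡[n+1]C[k+1] n (c * p + d) ⟨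
    n C (c * p + d) + n C suc (c * p + d)
      ≡⟨ cong (λ k → n C (c * p + d) + n C k) (+-suc (c * p) d) ⟨
    n C (c * p + d) + n C (c * p + suc d)
      ≈⟨ +-cong (lucas c d (<-trans (n<1+n d) 1+d<p)) (lucas c (suc d) 1+d<p) ⟩
    (a C c) * (b C d) + (a C c) * (b C suc d)
      ≈⟨ step c d 1+d<p ⟨
    (a′ C c) * (b′ C suc d) ∎
    where open ≈-Reasoning
  LucasAt-suc {n} {a} {b} {a′} {b′} lucas _ step-carry (suc c) zero _ = begin
    suc n C (suc c * p + 0)
      ≡⟨ cong (suc n C_) (carry c) ⟨
    suc n C suc (c * p + q)
      ≡⟨ nCk+nC[k+1]≡[n+1]C[k+1] n (c * p + q) ⟨
    n C (c * p + q) + n C suc (c * p + q)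
      ≡⟨ cong (λ k → n C (c * p + q) + n C k) (carry c) ⟩
    n C (c * p + q) + n C (suc c * p + 0)
      ≈⟨ +-cong (lucas c q ≤-refl) (lucas (suc c) 0 (s≤s z≤n)) ⟩
    (a C c) * (b C q) + (a C suc c) * (b C 0)
      ≈⟨ step-carry c ⟨
    (a′ C suc c) * (b′ C 0) ∎
    where open ≈-Reasoning

  LucasAt-0 : LucasAt 0 0 0
  LucasAt-0 zero    zero    _ = ≈-refl
  LucasAt-0 zero    (suc d) _ = ≈-refl
  LucasAt-0 (suc c) d       _ = ≈-refl

  lucas : ∀ a b → b < p → LucasAt (a * p + b) a b
  lucas zero    zero    _     = LucasAt-0
  lucas a       (suc b) 1+b<p = subst (λ n → LucasAt n a (suc b)) (sym (+-suc (a * p) b))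
    (LucasAt-suc (lucas a b (<-trans (n<1+n b) 1+b<p)) step step-carry)
    where
    step : ∀ c d → suc d < p → (a C c) * (suc b C suc d) ≈ (a C c) * (b C d) + (a C c) * (b C suc d)
    step c d _ = ≡⇒≈ (trans (cong ((a C c) *_) (sym (nCk+nC[k+1]≡[n+1]C[k+1] b d)))
                            (*-distribˡ-+ (a C c) (b C d) (b C suc d)))
    step-carry : ∀ c → (a C suc c) * (suc b C 0) ≈ (a C c) * (b C q) + (a C suc c) * (b C 0)
    step-carry c = ≡⇒≈ (begin
      (a C suc c) * 1
        ≡⟨ cong (_+ (a C suc c) * 1) (*-zeroʳ (a C c)) ⟨
      (a C c) * 0 + (a C suc c) * 1
        ≡⟨ cong (λ x → (a C c) * x + (a C suc c) * 1) (k>n⇒nCk≡0 (≤-pred 1+b<p)) ⟨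
      (a C c) * (b C q) + (a C suc c) * 1 ∎)
      where open ≡-Reasoning
  lucas (suc a) zero    _     = subst (λ n → LucasAt n (suc a) 0) (carry a)
    (LucasAt-suc (lucas a q ≤-refl) step step-carry)
    where
    step : ∀ c d → suc d < p → (suc a C c) * (0 C suc d) ≈ (a C c) * (q C d) + (a C c) * (q C suc d)
    step c d 1+d<p = begin
      (suc a C c) * 0
        ≡⟨ trans (*-zeroʳ (suc a C c)) (sym (*-zeroʳ (a C c))) ⟩
      (a C c) * 0
        ≈⟨ *-cong (≈-refl {a C c}) (∣⇒≈0 (p∣pCk (suc d) (s≤s z≤n) 1+d<p)) ⟨
      (a C c) * (p C suc d)
        ≡⟨ cong ((a C c) *_) (nCk+nC[k+1]≡[n+1]C[k+1] q d) ⟨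
      (a C c) * (q C d + q C suc d)
        ≡⟨ *-distribˡ-+ (a C c) (q C d) (q C suc d) ⟩
      (a C c) * (q C d) + (a C c) * (q C suc d) ∎
      where open ≈-Reasoning
    step-carry : ∀ c → (suc a C suc c) * (0 C 0) ≈ (a C c) * (q C q) + (a C suc c) * (q C 0)
    step-carry c = ≡⇒≈ (begin
      (suc a C suc c) * 1
        ≡⟨ *-identityʳ (suc a C suc c) ⟩
      suc a C suc c
        ≡⟨ nCk+nC[k+1]≡[n+1]C[k+1] a c ⟨
      a C c + a C suc c
        ≡⟨ cong₂ _+_ (*-identityʳ (a C c)) (*-identityʳ (a C suc c)) ⟨
      (a C c) * 1 + (a C suc c) * 1
        ≡⟨ cong (λ x → (a C c) * x + (a C suc c) * 1) (nCn≡1 q) ⟨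
      (a C c) * (q C q) + (a C suc c) * (q C 0) ∎)
      where open ≡-Reasoning

  binomial-oneStepLucas : OneStepLucas p _C_
  binomial-oneStepLucas a b c d b<p d<p = lucas a b b<p c d d<p

doubleBinomial : ℕ → ℕ → ℕ
doubleBinomial n k = (n C k) * ((2 * k) C n)

n<k⇒[mCk]*[nCm]≡0 : ∀ m {k n} → n < k → (m C k) * (n C m) ≡ 0
n<k⇒[mCk]*[nCm]≡0 m {k} {n} n<k with m <? k
... | yes m<k = cong (_* (n C m)) (k>n⇒nCk≡0 m<k)
... | no  m≮k = trans (cong ((m C k) *_) (k>n⇒nCk≡0 (<-≤-trans n<k (≮⇒≥ m≮k))))
                      (*-zeroʳ (m C k))

module _ (p : ℕ) .{{_ : NonZero p}} (lucas : OneStepLucas p _C_) where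

  open ℕMod p

  double-digits : ∀ c d → 2 * (c * p + d) ≡ 2 * c * p + 2 * d
  double-digits c d = trans (*-distribˡ-+ 2 (c * p) d) (cong (_+ 2 * d) (sym (*-assoc 2 c p)))

  doubleBinomial-oneStepLucas : OneStepLucas p doubleBinomial
  doubleBinomial-oneStepLucas a b c d b<p d<p with p ≤? 2 * d
  ... | no 2d≱p = begin
    doubleBinomial (a * p + b) (c * p + d)
      ≡⟨ cong (λ m → (n C k) * (m C n)) (double-digits c d) ⟩
    (n C k) * ((2 * c * p + 2 * d) C n)
      ≈⟨ *-cong (lucas a b c d b<p d<p) (lucas (2 * c) (2 * d) a b (≰⇒> 2d≱p) b<p) ⟩
    ((a C c) * (b C d)) * (((2 * c) C a) * ((2 * d) C b))
      ≡⟨ [m*n]*[o*p]≡[m*o]*[n*p] (a C c) (b C d) ((2 * c) C a) ((2 * d) C b) ⟩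
    doubleBinomial a c * doubleBinomial b d ∎
    where
    open ≈-Reasoning
    n = a * p + b
    k = c * p + d
  ... | yes 2d≥p = ≈-trans lhs≈0 (≈-sym rhs≈0)
    where
    n = a * p + b
    k = c * p + d
    e = 2 * d ∸ p
    p+e≡2d : p + e ≡ 2 * d
    p+e≡2d = m+[n∸m]≡n 2d≥p
    e<d : e < d
    e<d = +-cancelˡ-< p e d (begin-strict
      p + e  ≡⟨ p+e≡2d ⟩
      2 * d  ≡⟨ cong (d +_) (+-identityʳ d) ⟩
      d + d  <⟨ +-monoˡ-< d d<p ⟩
      p + d  ∎)
      where open ≤-Reasoning
    e<p : e < p
    e<p = <-trans e<d d<p
    2k≡[2c+1]p+e : 2 * k ≡ suc (2 * c) * p + e
    2k≡[2c+1]p+e = trans (double-digits c d)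
                         (trans (cong (2 * c * p +_) (sym p+e≡2d)) (identity (2 * c) p e))
      where
      identity : ∀ x p e → x * p + (p + e) ≡ suc x * p + e
      identity = solve-∀
    2d≡1*p+e : 2 * d ≡ 1 * p + e
    2d≡1*p+e = trans (sym p+e≡2d) (cong (_+ e) (sym (*-identityˡ p)))
    lhs≈0 : doubleBinomial n k ≈ 0
    lhs≈0 = begin
      (n C k) * ((2 * k) C n)
        ≡⟨ cong (λ m → (n C k) * (m C n)) 2k≡[2c+1]p+e ⟩
      (n C k) * ((suc (2 * c) * p + e) C n)
        ≈⟨ *-cong (lucas a b c d b<p d<p) (lucas (suc (2 * c)) e a b e<p b<p) ⟩
      ((a C c) * (b C d)) * ((suc (2 * c) C a) * (e C b))
        ≡⟨ [m*n]*[o*p]≡[m*o]*[n*p] (a C c) (b C d) (suc (2 * c) C a) (e C b) ⟩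
      ((a C c) * (suc (2 * c) C a)) * ((b C d) * (e C b))
        ≡⟨ cong ((a C c) * (suc (2 * c) C a) *_) (n<k⇒[mCk]*[nCm]≡0 b e<d) ⟩
      ((a C c) * (suc (2 * c) C a)) * 0
        ≡⟨ *-zeroʳ ((a C c) * (suc (2 * c) C a)) ⟩
      0 ∎
      where open ≈-Reasoning
    rhs≈0 : doubleBinomial a c * doubleBinomial b d ≈ 0
    rhs≈0 = begin
      doubleBinomial a c * ((b C d) * ((2 * d) C b))
        ≡⟨ cong (λ m → doubleBinomial a c * ((b C d) * (m C b))) 2d≡1*p+e ⟩
      doubleBinomial a c * ((b C d) * ((1 * p + e) C (0 * p + b)))
        ≈⟨ *-cong (≈-refl {doubleBinomial a c}) (*-cong (≈-refl {b C d}) (lucas 1 e 0 b e<p b<p)) ⟩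
      doubleBinomial a c * ((b C d) * ((1 C 0) * (e C b)))
        ≡⟨ cong (λ m → doubleBinomial a c * ((b C d) * m)) (*-identityˡ (e C b)) ⟩
      doubleBinomial a c * ((b C d) * (e C b))
        ≡⟨ cong (doubleBinomial a c *_) (n<k⇒[mCk]*[nCm]≡0 b e<d) ⟩
      doubleBinomial a c * 0
        ≡⟨ *-zeroʳ (doubleBinomial a c) ⟩
      0 ∎
      where open ≈-Reasoning

corollary3p5 : DoubleLucas L
corollary3p5 = vanishing , digitwise
  where
  vanishing : ∀ n k → n < k → L n k ≡ ℤ.+ 0
  vanishing n k n<k = cong ℤ.+_ (cong (_* ((2 * k) C n)) (k>n⇒nCk≡0 n<k))

  digitwise : ∀ p (p-prime : Prime p) n k r → n < p ^ suc r → k < p ^ suc r →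
    L n k ≡ digitProd L p {{prime⇒nonZero p-prime}} n k r [mod p ]
  digitwise zero    p-prime = contradiction p-prime ¬prime[0]
  digitwise p@(suc _) p-prime n k r n<pʳ⁺¹ k<pʳ⁺¹ =
    subst (λ x → L n k ≡ x [mod p ]) (sym (digitProd-+ p doubleBinomial n k r))
      (ℕMod.≈⇒≡[mod] p (oneStepLucas⇒digitwise p lucas r n k n<pʳ⁺¹ k<pʳ⁺¹))
    where
    lucas : OneStepLucas p doubleBinomial
    lucas = doubleBinomial-oneStepLucas p (BinomialLucas.binomial-oneStepLucas p-prime)
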